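{- Let $\mathcal{X}$ and $\mathcal{Y}$ be two classes of graphs such that $\mathcal{Y}$ is a function of $\mathcal{X}$. Then $\log |\mathcal{Y}^n| = O(\log |\mathcal{X}^n|)$ (as $n \to \infty$).
   Context: All graphs are finite and simple. A class of graphs is a set of graphs closed under isomorphism. For a class $\mathcal{X}$, $\mathcal{X}^n$ denotes the set of graphs in $\mathcal{X}$ with vertex set $[n]=\{1,\dots,n\}$. For a graph $G$ and distinct vertices $u,w$, $G(u,w)=1$ if $u,w$ are adjacent and $0$ otherwise. If $G,H_1,\dots,H_k$ are graphs on the same vertex set $V$, $G$ is a (boolean) function of $H_1,\dots,H_k$ if there is a boolean function $f:\{0,1\}^k\to\{0,1\}$ with $G(a,b)=f(H_1(a,b),\dots,H_k(a,b))$ for all distinct $a,b\in V$. A class $\mathcal{Y}$ is a $k$-function of a class $\mathcal{X}$ if every $G\in\mathcal{Y}$ is a function of at most $k$ graphs from $\mathcal{X}$ (on the vertex set of $G$); $\mathcal{Y}$ is a function of $\mathcal{X}$ if it is a $k$-function of $\mathcal{X}$ for some $k\in\mathbb{N}$. -}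

module Defs where

open import Data.Bool using (Bool; true; false)
open import Data.Unit using (⊤; tt)
open import Data.Nat using (ℕ; zero; suc; _≤_)
open import Data.Fin using (Fin; zero; suc)
open import Data.Fin.Permutation using (Permutation′; _⟨$⟩ʳ_)
open import Data.Vec using (Vec; []; _∷_; lookup; map)
open import Data.List using (List; []; _∷_; length; filterᵇ; cartesianProduct) renaming (map to mapL)
open import Data.Product using (_×_; _,_; Σ; ∃; ∃-syntax)
open import Relation.Binary.PropositionalEquality using (_≡_; _≢_)

-- Canonical encoding: a graph on suc n vertices is the adjacency row of
-- vertex 0 towards the other n vertices, together with the graph on the
-- remaining vertices 1..n.  This is a bijection with simple graphs on Fin n.
Graph : ℕ → Set
Graph zero = ⊤
Graph (suc n) = Vec Bool n × Graph n

adj : ∀ {n} → Graph n → Fin n → Fin n → Bool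
adj {suc n} (r , g) zero    zero    = false
adj {suc n} (r , g) zero    (suc j) = lookup r j
adj {suc n} (r , g) (suc i) zero    = lookup r i
adj {suc n} (r , g) (suc i) (suc j) = adj g i j

allBoolVecs : (n : ℕ) → List (Vec Bool n)
allBoolVecs zero = [] ∷ []
allBoolVecs (suc n) = mapL (λ p → Data.Product.proj₁ p ∷ Data.Product.proj₂ p)
                           (cartesianProduct (true ∷ false ∷ []) (allBoolVecs n))

allGraphs : (n : ℕ) → List (Graph n)
allGraphs zero = tt ∷ []
allGraphs (suc n) = cartesianProduct (allBoolVecs n) (allGraphs n)

Class : Set
Class = (n : ℕ) → Graph n → Bool

count : Class → ℕ → ℕ
count X n = length (filterᵇ (X n) (allGraphs n))

_≅_ : ∀ {n} → Graph n → Graph n → Set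
_≅_ {n} G H = Σ (Permutation′ n) λ σ →
  ∀ i j → adj H (σ ⟨$⟩ʳ i) (σ ⟨$⟩ʳ j) ≡ adj G i j

IsoClosed : Class → Set
IsoClosed X = ∀ n (G H : Graph n) → G ≅ H → X n G ≡ X n H

IsFunctionOf : ∀ {n m} → Graph n → Vec (Graph n) m → Set
IsFunctionOf {n} {m} G Hs = Σ (Vec Bool m → Bool) λ f →
  ∀ (a b : Fin n) → a ≢ b → adj G a b ≡ f (map (λ H → adj H a b) Hs)

AllIn : ∀ {n m} → Class → Vec (Graph n) m → Set
AllIn X [] = ⊤
AllIn {n} X (H ∷ Hs) = (X n H ≡ true) × AllIn X Hs

IsKFunctionOf : ℕ → Class → Class → Set
IsKFunctionOf k Y X = ∀ n (G : Graph n) → Y n G ≡ true →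
  ∃[ m ] (m ≤ k × Σ (Vec (Graph n) m) λ Hs → AllIn X Hs × IsFunctionOf G Hs)

IsFunctionOfClass : Class → Class → Set
IsFunctionOfClass Y X = ∃[ k ] IsKFunctionOf k Y X

{-# OPTIONS --safe #-}
module Submission where

-- A graph G of 𝒴ⁿ is recovered from the k graphs of 𝒳ⁿ it is a function of
-- (padding with dummy members of 𝒳ⁿ when it uses fewer) together with one of
-- the F = 2^(2^k) boolean functions on k bits.  Hence |𝒴ⁿ| ≤ F·|𝒳ⁿ|^k, and once
-- |𝒳ⁿ| ≥ 2 the constant F is absorbed as F ≤ |𝒳ⁿ|^F.

open import Defs
open import Data.Bool using (Bool; true; false; if_then_else_)
open import Data.Bool.Properties using (T-≡)
open import Data.Empty using (⊥-elim)
open import Data.Fin using (Fin; zero; suc)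
open import Data.Fin.Properties using (suc-injective)
open import Data.List
  using (List; []; _∷_; _++_; length; filterᵇ; cartesianProduct) renaming (map to mapL)
open import Data.List.Properties using (length-map; length-++; length-++-sucʳ)
open import Data.List.Membership.Propositional using (_∈_)
open import Data.List.Membership.Propositional.Properties
  using (∈-map⁺; ∈-cartesianProduct⁺; ∈-filter⁺; ∈-filter⁻; ∈-∃++; ∈-++⁺ˡ; ∈-++⁺ʳ; ∈-++⁻)
open import Data.List.Relation.Binary.Subset.Propositional using (_⊆_)
open import Data.List.Relation.Unary.All as All using ()
open import Data.List.Relation.Unary.AllPairs using ([]; _∷_)
open import Data.List.Relation.Unary.Any using (here; there)
open import Data.List.Relation.Unary.Unique.Propositional using (Unique)
import Data.List.Relation.Unary.Unique.Propositional.Properties as Unique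
open import Data.Nat
  using (ℕ; zero; suc; _+_; _*_; _^_; _≤_; _<_; _≤′_; ≤′-refl; ≤′-step; z≤n; s≤s)
open import Data.Nat.Properties
  using ( ≤-trans; ≤-reflexive; ≤-<-trans; <⇒≤; n<1+n; *-monoˡ-≤; ^-monoʳ-<; ^-distribˡ-+-*
        ; ≤⇒≤′; module ≤-Reasoning)
open import Data.Product using (Σ; _×_; _,_; proj₁; proj₂; uncurry; ∃-syntax)
open import Data.Sum using (inj₁; inj₂)
open import Data.Unit using (tt)
open import Data.Vec using (Vec; []; _∷_; tabulate; tail) renaming (map to mapV)
open import Data.Vec.Properties using (∷-injective; tabulate∘lookup; tabulate-cong)
open import Data.Vec.Relation.Unary.All using (All; []; _∷_) renaming (map to mapAll)
open import Function using (_∘_; const; Equivalence)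
open import Relation.Binary.PropositionalEquality
  using (_≡_; _≢_; _≗_; refl; sym; trans; cong; cong₂; subst; module ≡-Reasoning)

private
  variable
    A B : Set
    m k n : ℕ

length-≤-of-⊆ : {xs ys : List A} → Unique xs → xs ⊆ ys → length xs ≤ length ys
length-≤-of-⊆ {xs = []} _ _ = z≤n
length-≤-of-⊆ {xs = x ∷ xs} (x∉xs ∷ xs!) x∷xs⊆ys with ∈-∃++ (x∷xs⊆ys (here refl))
... | us , vs , refl =
  ≤-trans (s≤s (length-≤-of-⊆ xs! xs⊆us++vs)) (≤-reflexive (sym (length-++-sucʳ us x vs)))
  where
  xs⊆us++vs : xs ⊆ us ++ vs
  xs⊆us++vs y∈xs with ∈-++⁻ us (x∷xs⊆ys (there y∈xs))
  ... | inj₁ y∈us         = ∈-++⁺ˡ y∈us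
  ... | inj₂ (here refl)  = ⊥-elim (All.lookup x∉xs y∈xs refl)
  ... | inj₂ (there y∈vs) = ∈-++⁺ʳ us y∈vs

length-cartesianProduct : (xs : List A) (ys : List B) →
  length (cartesianProduct xs ys) ≡ length xs * length ys
length-cartesianProduct [] ys = refl
length-cartesianProduct (x ∷ xs) ys = begin
  length (mapL (x ,_) ys ++ cartesianProduct xs ys)      ≡⟨ length-++ (mapL (x ,_) ys) ⟩
  length (mapL (x ,_) ys) + length (cartesianProduct xs ys)
    ≡⟨ cong₂ _+_ (length-map (x ,_) ys) (length-cartesianProduct xs ys) ⟩
  length ys + length xs * length ys                      ∎
  where open ≡-Reasoning

allVecs : List A → (m : ℕ) → List (Vec A m)
allVecs xs zero    = [] ∷ []
allVecs xs (suc m) = mapL (λ p → proj₁ p ∷ proj₂ p) (cartesianProduct xs (allVecs xs m))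

allVecs-complete : {xs : List A} {v : Vec A m} → All (_∈ xs) v → v ∈ allVecs xs m
allVecs-complete []           = here refl
allVecs-complete (x∈xs ∷ v∈) =
  ∈-map⁺ (λ p → proj₁ p ∷ proj₂ p) (∈-cartesianProduct⁺ x∈xs (allVecs-complete v∈))

allVecs-unique : {xs : List A} → Unique xs → (m : ℕ) → Unique (allVecs xs m)
allVecs-unique xs! zero    = All.[] ∷ []
allVecs-unique xs! (suc m) =
  Unique.map⁺ (uncurry (cong₂ _,_) ∘ ∷-injective)
    (Unique.cartesianProduct⁺ xs! (allVecs-unique xs! m))

length-allVecs : (xs : List A) (m : ℕ) → length (allVecs xs m) ≡ length xs ^ m
length-allVecs xs zero    = refl
length-allVecs xs (suc m) =
  trans (length-map _ (cartesianProduct xs (allVecs xs m)))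
    (trans (length-cartesianProduct xs (allVecs xs m))
      (cong (length xs *_) (length-allVecs xs m)))

bools : List Bool
bools = true ∷ false ∷ []

bools-complete : (b : Bool) → b ∈ bools
bools-complete true  = here refl
bools-complete false = there (here refl)

bools-unique : Unique bools
bools-unique = ((λ ()) All.∷ All.[]) ∷ All.[] ∷ []

allBoolVecs≡allVecs : (n : ℕ) → allBoolVecs n ≡ allVecs bools n
allBoolVecs≡allVecs zero    = refl
allBoolVecs≡allVecs (suc n) =
  cong (mapL (λ p → proj₁ p ∷ proj₂ p) ∘ cartesianProduct bools) (allBoolVecs≡allVecs n)

allBoolVecs-complete : (v : Vec Bool n) → v ∈ allBoolVecs n
allBoolVecs-complete {n} v =
  subst (v ∈_) (sym (allBoolVecs≡allVecs n)) (allVecs-complete (all-∈-bools v))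
  where
  all-∈-bools : (v : Vec Bool m) → All (_∈ bools) v
  all-∈-bools []      = []
  all-∈-bools (b ∷ v) = bools-complete b ∷ all-∈-bools v

allBoolVecs-unique : (n : ℕ) → Unique (allBoolVecs n)
allBoolVecs-unique n =
  subst Unique (sym (allBoolVecs≡allVecs n)) (allVecs-unique bools-unique n)

allGraphs-complete : (G : Graph n) → G ∈ allGraphs n
allGraphs-complete {zero}  tt      = here refl
allGraphs-complete {suc n} (r , G) =
  ∈-cartesianProduct⁺ (allBoolVecs-complete r) (allGraphs-complete G)

allGraphs-unique : (n : ℕ) → Unique (allGraphs n)
allGraphs-unique zero    = All.[] ∷ []
allGraphs-unique (suc n) =
  Unique.cartesianProduct⁺ (allBoolVecs-unique n) (allGraphs-unique n)

members : Class → (n : ℕ) → List (Graph n)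
members X n = filterᵇ (X n) (allGraphs n)

members-unique : (X : Class) (n : ℕ) → Unique (members X n)
members-unique X n = Unique.filter⁺ _ (allGraphs-unique n)

∈-members⁺ : (X : Class) {G : Graph n} → X n G ≡ true → G ∈ members X n
∈-members⁺ X {G} XG = ∈-filter⁺ _ (allGraphs-complete G) (Equivalence.from T-≡ XG)

∈-members⁻ : (X : Class) {G : Graph n} → G ∈ members X n → X n G ≡ true
∈-members⁻ {n} X G∈ = Equivalence.to T-≡ (proj₂ (∈-filter⁻ _ {xs = allGraphs n} G∈))

member-of-count≥1 : (X : Class) (n : ℕ) → 1 ≤ count X n → ∃[ G ] X n G ≡ true
member-of-count≥1 X n 1≤count with members X n in eq
... | G ∷ _ = G , ∈-members⁻ X (subst (G ∈_) (sym eq) (here refl))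

fromAdj : (Fin n → Fin n → Bool) → Graph n
fromAdj {zero}  A = tt
fromAdj {suc n} A = tabulate (A zero ∘ suc) , fromAdj (λ i j → A (suc i) (suc j))

≡-fromAdj : (G : Graph n) (A : Fin n → Fin n → Bool) →
  (∀ a b → a ≢ b → adj G a b ≡ A a b) → G ≡ fromAdj A
≡-fromAdj {zero}  tt      A G≈A = refl
≡-fromAdj {suc n} (r , G) A G≈A = cong₂ _,_
  (trans (sym (tabulate∘lookup r)) (tabulate-cong (λ j → G≈A zero (suc j) (λ ()))))
  (≡-fromAdj G _ (λ a b a≢b → G≈A (suc a) (suc b) (a≢b ∘ suc-injective)))

branch : (Vec Bool m → Bool) → (Vec Bool m → Bool) → Vec Bool (suc m) → Bool
branch f g (b ∷ v) = if b then f v else g v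

allBoolFuns : (m : ℕ) → List (Vec Bool m → Bool)
allBoolFuns zero    = mapL const bools
allBoolFuns (suc m) = mapL (uncurry branch) (cartesianProduct (allBoolFuns m) (allBoolFuns m))

allBoolFuns-complete : (f : Vec Bool m → Bool) → ∃[ g ] g ∈ allBoolFuns m × f ≗ g
allBoolFuns-complete {zero} f =
  const (f []) , ∈-map⁺ const (bools-complete (f [])) , λ { [] → refl }
allBoolFuns-complete {suc m} f
  with g₁ , g₁∈ , f₁≗g₁ ← allBoolFuns-complete (f ∘ (true ∷_))
     | g₀ , g₀∈ , f₀≗g₀ ← allBoolFuns-complete (f ∘ (false ∷_)) =
  branch g₁ g₀ , ∈-map⁺ (uncurry branch) (∈-cartesianProduct⁺ g₁∈ g₀∈) ,
  λ { (true ∷ v) → f₁≗g₁ v ; (false ∷ v) → f₀≗g₀ v }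

combine : (Vec Bool m → Bool) → Vec (Graph n) m → Graph n
combine f Hs = fromAdj (λ a b → f (mapV (λ H → adj H a b) Hs))

combinations : (k : ℕ) → List (Graph n) → List (Graph n)
combinations k graphs =
  mapL (uncurry combine) (cartesianProduct (allBoolFuns k) (allVecs graphs k))

length-combinations : (k : ℕ) (graphs : List (Graph n)) →
  length (combinations k graphs) ≡ length (allBoolFuns k) * length graphs ^ k
length-combinations {n} k graphs = begin
  length (combinations k graphs)
    ≡⟨ length-map (uncurry combine) pairs ⟩
  length pairs
    ≡⟨ length-cartesianProduct (allBoolFuns k) (allVecs graphs k) ⟩
  length (allBoolFuns k) * length (allVecs graphs k)
    ≡⟨ cong (length (allBoolFuns k) *_) (length-allVecs graphs k) ⟩
  length (allBoolFuns k) * length graphs ^ k ∎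
  where
  open ≡-Reasoning
  pairs : List ((Vec Bool k → Bool) × Vec (Graph n) k)
  pairs = cartesianProduct (allBoolFuns k) (allVecs graphs k)

IsFunctionOf⇒≡combine : {G : Graph n} {Hs : Vec (Graph n) m} → IsFunctionOf G Hs →
  ∃[ g ] g ∈ allBoolFuns m × G ≡ combine g Hs
IsFunctionOf⇒≡combine {G = G} (f , G≈fHs) with g , g∈ , f≗g ← allBoolFuns-complete f =
  g , g∈ , ≡-fromAdj G _ (λ a b a≢b → trans (G≈fHs a b a≢b) (f≗g _))

IsFunctionOf-∷ : {G : Graph n} {Hs : Vec (Graph n) m} (H : Graph n) →
  IsFunctionOf G Hs → IsFunctionOf G (H ∷ Hs)
IsFunctionOf-∷ H (f , G≈fHs) = f ∘ tail , G≈fHs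

AllIn⇒All : {X : Class} {Hs : Vec (Graph n) m} → AllIn X Hs → All (λ H → X n H ≡ true) Hs
AllIn⇒All {Hs = []}     tt          = []
AllIn⇒All {Hs = H ∷ Hs} (XH , Hs∈X) = XH ∷ AllIn⇒All Hs∈X

IsKFunctionOf⇒exactly : {X Y : Class} → IsKFunctionOf k Y X →
  {H₀ : Graph n} → X n H₀ ≡ true → {G : Graph n} → Y n G ≡ true →
  Σ (Vec (Graph n) k) λ Hs → AllIn X Hs × IsFunctionOf G Hs
IsKFunctionOf⇒exactly {n = n} {X = X} Y⊆X^k {H₀} XH₀ {G} YG
  with m , m≤k , Hs , Hs∈X , G=fHs ← Y⊆X^k n G YG = pad (≤⇒≤′ m≤k) Hs∈X G=fHs
  where
  pad : ∀ {m k} → m ≤′ k → {Hs : Vec (Graph n) m} → AllIn X Hs → IsFunctionOf G Hs →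
    Σ (Vec (Graph n) k) λ Hs′ → AllIn X Hs′ × IsFunctionOf G Hs′
  pad ≤′-refl       Hs∈X G=fHs = _ , Hs∈X , G=fHs
  pad (≤′-step m≤k) Hs∈X G=fHs with Hs′ , Hs′∈X , G=fHs′ ← pad m≤k Hs∈X G=fHs =
    H₀ ∷ Hs′ , (XH₀ , Hs′∈X) , IsFunctionOf-∷ H₀ G=fHs′

count-≤-of-IsKFunctionOf : {X Y : Class} → IsKFunctionOf k Y X →
  {H₀ : Graph n} → X n H₀ ≡ true → count Y n ≤ length (allBoolFuns k) * count X n ^ k
count-≤-of-IsKFunctionOf {k} {n} {X} {Y} Y⊆X^k XH₀ =
  ≤-trans (length-≤-of-⊆ (members-unique Y n) members-⊆-combinations)
          (≤-reflexive (length-combinations k (members X n)))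
  where
  members-⊆-combinations : members Y n ⊆ combinations k (members X n)
  members-⊆-combinations G∈Y
    with Hs , Hs∈X , G=fHs ← IsKFunctionOf⇒exactly Y⊆X^k XH₀ (∈-members⁻ Y G∈Y)
    with g , g∈ , refl ← IsFunctionOf⇒≡combine G=fHs =
    ∈-map⁺ (uncurry combine)
      (∈-cartesianProduct⁺ g∈ (allVecs-complete (mapAll (∈-members⁺ X) (AllIn⇒All Hs∈X))))

n<m^n : {m : ℕ} → 1 < m → (n : ℕ) → n < m ^ n
n<m^n 1<m zero    = s≤s z≤n
n<m^n {m} 1<m (suc n) = ≤-<-trans (n<m^n 1<m n) (^-monoʳ-< m 1<m (n<1+n n))

lemma3p1 : (X Y : Class) → IsoClosed X → IsoClosed Y →
    IsFunctionOfClass Y X →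
    (∃[ N₀ ] (∀ n → N₀ ≤ n → 2 ≤ count X n)) →
    ∃[ C ] ∃[ N ] (∀ n → N ≤ n → count Y n ≤ count X n ^ C)
lemma3p1 X Y _ _ (k , Y⊆X^k) (N₀ , 2≤count) = F + k , N₀ , bound
  where
  F : ℕ
  F = length (allBoolFuns k)

  bound : ∀ n → N₀ ≤ n → count Y n ≤ count X n ^ (F + k)
  bound n N₀≤n with H₀ , XH₀ ← member-of-count≥1 X n (<⇒≤ (2≤count n N₀≤n)) = begin
    count Y n      ≤⟨ count-≤-of-IsKFunctionOf Y⊆X^k XH₀ ⟩
    F * x ^ k      ≤⟨ *-monoˡ-≤ (x ^ k) (<⇒≤ (n<m^n 2≤x F)) ⟩
    x ^ F * x ^ k  ≡⟨ sym (^-distribˡ-+-* x F k) ⟩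
    x ^ (F + k)    ∎
    where
    open ≤-Reasoning
    x : ℕ
    x = count X n
    2≤x : 2 ≤ x
    2≤x = 2≤count n N₀≤n
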